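{- Let $n\ge 1$, $1\le m\le n$ and $0\le t\le m-1$ be integers, and let $B_n(m,t)$ be the flag-shaped blocker. For any position $b$ of $B_n(m,t)$ lying in the first row of the matrix, there exists an $n\times n$ $123$-avoiding permutation matrix $P$ that intersects $B_n(m,t)$ at most once, at $b$; that is, $P$ has a $1$ in position $b$ and has no $1$ in any other position of $B_n(m,t)$.
   Context: A permutation matrix $P$ contains a $123$-pattern if the $3\times 3$ identity matrix $I_3$ is a submatrix of $P$; otherwise $P$ is $123$-avoiding. For integers $1\le m\le n$, $0\le t\le m-1$, the flag-shaped set $B_n(m,t)$ of positions of an $n\times n$ matrix is the union of $\{(i,m): 1\le i\le n-t\}$ and $\{(i,j): 1\le i\le n-m+1,\ m-t\le j\le m-1\}$, positions written as (row, column). It is a blocker: every $n\times n$ $123$-avoiding permutation matrix has a $1$ in some position of it. -}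

module Defs where

open import Data.Nat using (ℕ; suc; _+_; _∸_; _≤_; _<_)
open import Data.Fin using (Fin; toℕ)
open import Data.Product using (_×_; ∃-syntax)
open import Data.Sum using (_⊎_)
open import Relation.Nullary using (¬_)
open import Function.Definitions using (Injective)
open import Relation.Binary.PropositionalEquality using (_≡_)

-- An n×n permutation matrix is given by a permutation σ of Fin n
-- (an injective map Fin n → Fin n, hence a bijection); its 1s are at
-- positions (r, σ r). Positions are 1-based (row, column) pairs of ℕ.
record Perm (n : ℕ) : Set where
  field
    σ   : Fin n → Fin n
    inj : Injective _≡_ _≡_ σ
open Perm public

HasOne : {n : ℕ} → Perm n → ℕ → ℕ → Set
HasOne P i j = ∃[ r ] (suc (toℕ r) ≡ i × suc (toℕ (σ P r)) ≡ j)

Contains123 : {n : ℕ} → Perm n → Set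
Contains123 P = ∃[ r₁ ] ∃[ r₂ ] ∃[ r₃ ]
  (toℕ r₁ < toℕ r₂ × toℕ r₂ < toℕ r₃ ×
   toℕ (σ P r₁) < toℕ (σ P r₂) × toℕ (σ P r₂) < toℕ (σ P r₃))

Avoids123 : {n : ℕ} → Perm n → Set
Avoids123 P = ¬ Contains123 P

InB : ℕ → ℕ → ℕ → ℕ → ℕ → Set
InB n m t i j =
    (j ≡ m × 1 ≤ i × i ≤ n ∸ t)
  ⊎ (1 ≤ i × i ≤ n ∸ m + 1 × m ∸ t ≤ j × j ≤ m ∸ 1)

-- Write n = k + m and let the first row have its 1 in column a + 1, so a < m; rows and
-- values are counted from 0 below. The witness is the inflation of 2413 by decreasing
-- blocks: row 0 holds a, the next k rows hold the values ≥ m, the next a rows the values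
-- < a, and the remaining rows the values strictly between a and m, each block in
-- decreasing order. An ascent only goes from the first or third block to the second or
-- fourth, and no block is on both sides, so there is no 123. The second block lies right
-- of the flag, the third and fourth lie below its cloth, and the only candidate on the
-- pole, the value m − 1, is either a itself or sits in row k + a + 1 of the fourth block,
-- below the pole because a + 1 + t ≥ m.
module Submission where

open import Defs
open import Data.Nat using (ℕ; zero; suc; _+_; _∸_; _≤_; _<_; z≤n; s≤s; s≤s⁻¹; _≤?_)
open import Data.Nat.Properties
open import Data.Fin using (Fin; toℕ; fromℕ<)
open import Data.Fin.Properties using (toℕ-fromℕ<; toℕ-injective; toℕ<n)
open import Data.Product using (_×_; _,_; proj₁; proj₂; ∃-syntax)
open import Data.Sum using (inj₁; inj₂)
open import Data.Empty using (⊥; ⊥-elim)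
open import Relation.Nullary using (yes; no)
open import Relation.Binary using (tri<; tri≈; tri>)
open import Relation.Binary.PropositionalEquality
  using (_≡_; refl; sym; trans; cong; subst; subst₂; module ≡-Reasoning)

first-row-column : ∀ {n m t j} → 1 ≤ m → t ≤ m ∸ 1 → InB n m t 1 j →
  ∃[ a ] (j ≡ suc a × a < m × m ≤ suc (a + t))
first-row-column {m = suc m'} {t} _ _ (inj₁ (refl , _ , _)) =
  m' , refl , ≤-refl , s≤s (m≤m+n m' t)
first-row-column {m = suc m'} {t} {zero} _ t≤m' (inj₂ (_ , _ , m∸t≤0 , _)) =
  ⊥-elim (<⇒≱ (s≤s t≤m') (m∸n≡0⇒m≤n (n≤0⇒n≡0 m∸t≤0)))
first-row-column {m = suc m'} {t} {suc a} _ _ (inj₂ (_ , _ , m∸t≤j , j≤m')) =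
  a , refl , m≤n⇒m≤1+n j≤m' ,
  subst (suc m' ≤_) (+-comm t (suc a)) (≤-trans (m≤n+m∸n (suc m') t) (+-monoʳ-≤ t m∸t≤j))

module InflatedPermutation (k m a : ℕ) (a<m : a < m) where

  N : ℕ
  N = k + m

  data Block : Set where
    pivot upper lower middle : Block

  data BlockView : ℕ → Block → Set where
    pivot-row  : BlockView 0 pivot
    upper-row  : ∀ {r} → suc r ≤ k → BlockView (suc r) upper
    lower-row  : ∀ {r} → k < r → r ≤ k + a → BlockView r lower
    middle-row : ∀ {r} → k + a < r → r < N → BlockView r middle

  classify : ∀ r → r < N → ∃[ x ] BlockView r x
  classify zero _ = pivot , pivot-row
  classify (suc r) r<N with suc r ≤? k | suc r ≤? k + a
  ... | yes r+1≤k | _         = upper , upper-row r+1≤k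
  ... | no  r+1≰k | yes r+1≤k+a = lower , lower-row (≰⇒> r+1≰k) r+1≤k+a
  ... | no  _     | no  r+1≰k+a = middle , middle-row (≰⇒> r+1≰k+a) r<N

  top : Block → ℕ
  top pivot  = a
  top upper  = N
  top lower  = k + a
  top middle = a + N

  entry : Block → ℕ → ℕ
  entry x r = top x ∸ r

  InBand : Block → ℕ → Set
  InBand pivot  v = v ≡ a
  InBand upper  v = m ≤ v
  InBand lower  v = v < a
  InBand middle v = a < v × v < m

  row≤top : ∀ {r x} → BlockView r x → r ≤ top x
  row≤top pivot-row           = z≤n
  row≤top (upper-row r≤k)     = ≤-trans r≤k (m≤m+n k m)
  row≤top (lower-row _ r≤k+a) = r≤k+a
  row≤top (middle-row _ r<N)  = ≤-trans (<⇒≤ r<N) (m≤n+m N a)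

  entry-decreasing : ∀ {r₁ r₂ x} → BlockView r₂ x → r₁ < r₂ → entry x r₂ < entry x r₁
  entry-decreasing w r₁<r₂ = ∸-monoʳ-< r₁<r₂ (row≤top w)

  a+N∸[k+a]≡m : a + N ∸ (k + a) ≡ m
  a+N∸[k+a]≡m = begin
    a + (k + m) ∸ (k + a) ≡⟨ cong (_∸ (k + a)) (sym (+-assoc a k m)) ⟩
    a + k + m ∸ (k + a)   ≡⟨ cong (λ s → s + m ∸ (k + a)) (+-comm a k) ⟩
    k + a + m ∸ (k + a)   ≡⟨ m+n∸m≡n (k + a) m ⟩
    m                     ∎
    where open ≡-Reasoning

  entry-in-band : ∀ {r x} → BlockView r x → InBand x (entry x r)
  entry-in-band pivot-row = refl
  entry-in-band {suc r} (upper-row r+1≤k) =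
    m+n≤o⇒m≤o∸n m (subst (_≤ N) (+-comm (suc r) m) (+-monoˡ-≤ m r+1≤k))
  entry-in-band {r} (lower-row k<r r≤k+a) =
    subst (k + a ∸ r <_) (m+n∸m≡n k a) (∸-monoʳ-< k<r r≤k+a)
  entry-in-band {r} w@(middle-row k+a<r r<N) =
    m+n≤o⇒m≤o∸n (suc a) (+-monoʳ-< a r<N) ,
    subst (a + N ∸ r <_) a+N∸[k+a]≡m (entry-decreasing w k+a<r)

  entry<N : ∀ {r x} → BlockView r x → entry x r < N
  entry<N pivot-row           = <-≤-trans a<m (m≤n+m m k)
  entry<N w@(upper-row _)     = entry-decreasing w (s≤s z≤n)
  entry<N {r} (lower-row _ _) = ≤-<-trans (m∸n≤m (k + a) r) (+-monoʳ-< k a<m)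
  entry<N w@(middle-row _ _)  = <-≤-trans (proj₂ (entry-in-band w)) (m≤n+m m k)

  band-unique : ∀ {x y v} → InBand x v → InBand y v → x ≡ y
  band-unique {pivot}  {pivot}  _ _ = refl
  band-unique {upper}  {upper}  _ _ = refl
  band-unique {lower}  {lower}  _ _ = refl
  band-unique {middle} {middle} _ _ = refl
  band-unique {pivot}  {upper}  refl m≤a       = ⊥-elim (<⇒≱ a<m m≤a)
  band-unique {upper}  {pivot}  m≤a refl       = ⊥-elim (<⇒≱ a<m m≤a)
  band-unique {pivot}  {lower}  refl a<a       = ⊥-elim (<-irrefl refl a<a)
  band-unique {lower}  {pivot}  a<a refl       = ⊥-elim (<-irrefl refl a<a)
  band-unique {pivot}  {middle} refl (a<a , _) = ⊥-elim (<-irrefl refl a<a)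
  band-unique {middle} {pivot}  (a<a , _) refl = ⊥-elim (<-irrefl refl a<a)
  band-unique {upper}  {lower}  m≤v v<a       = ⊥-elim (<⇒≱ (<-trans v<a a<m) m≤v)
  band-unique {lower}  {upper}  v<a m≤v       = ⊥-elim (<⇒≱ (<-trans v<a a<m) m≤v)
  band-unique {upper}  {middle} m≤v (_ , v<m) = ⊥-elim (<⇒≱ v<m m≤v)
  band-unique {middle} {upper}  (_ , v<m) m≤v = ⊥-elim (<⇒≱ v<m m≤v)
  band-unique {lower}  {middle} v<a (a<v , _) = ⊥-elim (<-asym v<a a<v)
  band-unique {middle} {lower}  (a<v , _) v<a = ⊥-elim (<-asym v<a a<v)

  entries-distinct : ∀ {r₁ r₂ x y} → BlockView r₁ x → BlockView r₂ y → r₁ < r₂ →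
    entry x r₁ ≡ entry y r₂ → ⊥
  entries-distinct {y = y} w₁ w₂ r₁<r₂ e
    with band-unique (entry-in-band w₁) (subst (InBand y) (sym e) (entry-in-band w₂))
  ... | refl = <-irrefl (sym e) (entry-decreasing w₂ r₁<r₂)

  -- The ascents of the pattern 2413 that is being inflated.
  data Ascent : Block → Block → Set where
    pivot-upper  : Ascent pivot upper
    pivot-middle : Ascent pivot middle
    lower-middle : Ascent lower middle

  no-ascent-chain : ∀ {x y z} → Ascent x y → Ascent y z → ⊥
  no-ascent-chain pivot-upper  ()
  no-ascent-chain pivot-middle ()
  no-ascent-chain lower-middle ()

  ascent : ∀ {r₁ r₂ x y} → BlockView r₁ x → BlockView r₂ y → r₁ < r₂ →
    entry x r₁ < entry y r₂ → Ascent x y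
  ascent pivot-row       (upper-row _)    _ _ = pivot-upper
  ascent pivot-row       (middle-row _ _) _ _ = pivot-middle
  ascent (lower-row _ _) (middle-row _ _) _ _ = lower-middle
  ascent _ pivot-row ()
  ascent pivot-row w₂@(lower-row _ _) _ v₁<v₂ =
    ⊥-elim (<-asym v₁<v₂ (entry-in-band w₂))
  ascent w₁@(upper-row _) w₂@(lower-row _ _) _ v₁<v₂ =
    ⊥-elim (<⇒≱ (<-trans v₁<v₂ (<-trans (entry-in-band w₂) a<m)) (entry-in-band w₁))
  ascent w₁@(upper-row _) w₂@(middle-row _ _) _ v₁<v₂ =
    ⊥-elim (<⇒≱ (<-trans v₁<v₂ (proj₂ (entry-in-band w₂))) (entry-in-band w₁))
  ascent (lower-row k<r₁ _) (upper-row r₂≤k) r₁<r₂ _ =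
    ⊥-elim (<⇒≱ r₁<r₂ (≤-trans r₂≤k (<⇒≤ k<r₁)))
  ascent (middle-row k+a<r₁ _) (upper-row r₂≤k) r₁<r₂ _ =
    ⊥-elim (<⇒≱ r₁<r₂ (≤-trans r₂≤k (≤-trans (m≤m+n k a) (<⇒≤ k+a<r₁))))
  ascent (middle-row k+a<r₁ _) (lower-row _ r₂≤k+a) r₁<r₂ _ =
    ⊥-elim (<⇒≱ r₁<r₂ (≤-trans r₂≤k+a (<⇒≤ k+a<r₁)))
  ascent (upper-row _)    w₂@(upper-row _)    r₁<r₂ v₁<v₂ =
    ⊥-elim (<-asym v₁<v₂ (entry-decreasing w₂ r₁<r₂))
  ascent (lower-row _ _)  w₂@(lower-row _ _)  r₁<r₂ v₁<v₂ =
    ⊥-elim (<-asym v₁<v₂ (entry-decreasing w₂ r₁<r₂))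
  ascent (middle-row _ _) w₂@(middle-row _ _) r₁<r₂ v₁<v₂ =
    ⊥-elim (<-asym v₁<v₂ (entry-decreasing w₂ r₁<r₂))

  pivot-entry : ∀ {r x} → BlockView r x → r ≡ 0 → entry x r ≡ a
  pivot-entry pivot-row         _    = refl
  pivot-entry (lower-row () _)  refl
  pivot-entry (middle-row () _) refl

  flag-row-bound : ∀ {r} → suc r ≤ N ∸ m + 1 → r ≤ k
  flag-row-bound {r} h =
    s≤s⁻¹ (subst (suc r ≤_) (trans (cong (_+ 1) (m+n∸n≡m k m)) (+-comm k 1)) h)

  flag-entry-is-pivot : ∀ {t r x} → m ≤ suc (a + t) → BlockView r x →
    InB N m t (suc r) (suc (entry x r)) → r ≡ 0 × entry x r ≡ a
  flag-entry-is-pivot _ pivot-row _ = refl , refl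
  flag-entry-is-pivot _ w@(upper-row _) (inj₁ (v+1≡m , _)) =
    ⊥-elim (<-irrefl (sym v+1≡m) (s≤s (entry-in-band w)))
  flag-entry-is-pivot _ w@(upper-row _) (inj₂ (_ , _ , _ , v+1≤m∸1)) =
    ⊥-elim (<⇒≱ (≤-trans v+1≤m∸1 (m∸n≤m m 1)) (entry-in-band w))
  flag-entry-is-pivot _ w@(lower-row _ _) (inj₁ (v+1≡m , _)) =
    ⊥-elim (<-irrefl v+1≡m (<-≤-trans (s≤s (entry-in-band w)) a<m))
  flag-entry-is-pivot _ (lower-row k<r _) (inj₂ (_ , r+1≤ , _)) =
    ⊥-elim (<⇒≱ k<r (flag-row-bound r+1≤))
  flag-entry-is-pivot _ (middle-row k+a<r _) (inj₂ (_ , r+1≤ , _)) =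
    ⊥-elim (<⇒≱ k+a<r (≤-trans (flag-row-bound r+1≤) (m≤m+n k a)))
  flag-entry-is-pivot {t} {r} m≤1+a+t (middle-row k+a<r _) (inj₁ (_ , _ , r+1≤N∸t)) =
    ⊥-elim (<-irrefl refl k+a+2≤k+a+1)
    where
      open ≤-Reasoning
      k+a+2≤k+a+1 : suc (suc (k + a)) ≤ suc (k + a)
      k+a+2≤k+a+1 = begin
        suc (suc (k + a))     ≤⟨ s≤s k+a<r ⟩
        suc r                 ≤⟨ r+1≤N∸t ⟩
        k + m ∸ t             ≤⟨ ∸-monoˡ-≤ t (+-monoʳ-≤ k m≤1+a+t) ⟩
        k + (suc a + t) ∸ t   ≡⟨ cong (_∸ t) (sym (+-assoc k (suc a) t)) ⟩
        k + suc a + t ∸ t     ≡⟨ m+n∸n≡m (k + suc a) t ⟩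
        k + suc a             ≡⟨ +-suc k a ⟩
        suc (k + a)           ∎

  block : Fin N → Block
  block r = proj₁ (classify (toℕ r) (toℕ<n r))

  view : (r : Fin N) → BlockView (toℕ r) (block r)
  view r = proj₂ (classify (toℕ r) (toℕ<n r))

  value : Fin N → Fin N
  value r = fromℕ< (entry<N (view r))

  toℕ-value : ∀ r → toℕ (value r) ≡ entry (block r) (toℕ r)
  toℕ-value r = toℕ-fromℕ< (entry<N (view r))

  value-injective : ∀ {r₁ r₂} → value r₁ ≡ value r₂ → r₁ ≡ r₂
  value-injective {r₁} {r₂} e
    with <-cmp (toℕ r₁) (toℕ r₂) | trans (sym (toℕ-value r₁)) (trans (cong toℕ e) (toℕ-value r₂))
  ... | tri< r₁<r₂ _ _ | entries-equal =
    ⊥-elim (entries-distinct (view r₁) (view r₂) r₁<r₂ entries-equal)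
  ... | tri≈ _ r₁≡r₂ _ | _ = toℕ-injective r₁≡r₂
  ... | tri> _ _ r₂<r₁ | entries-equal =
    ⊥-elim (entries-distinct (view r₂) (view r₁) r₂<r₁ (sym entries-equal))

  permutation : Perm N
  permutation = record { σ = value ; inj = value-injective }

  avoids123 : Avoids123 permutation
  avoids123 (r₁ , r₂ , r₃ , r₁<r₂ , r₂<r₃ , v₁<v₂ , v₂<v₃) =
    no-ascent-chain (ascent-between r₁<r₂ v₁<v₂) (ascent-between r₂<r₃ v₂<v₃)
    where
      ascent-between : ∀ {r r'} → toℕ r < toℕ r' → toℕ (value r) < toℕ (value r') →
        Ascent (block r) (block r')
      ascent-between {r} {r'} r<r' v<v' =
        ascent (view r) (view r') r<r' (subst₂ _<_ (toℕ-value r) (toℕ-value r') v<v')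

  has-pivot : HasOne permutation 1 (suc a)
  has-pivot = row₀ , cong suc row₀≡0 ,
    cong suc (trans (toℕ-value row₀) (pivot-entry (view row₀) row₀≡0))
    where
      0<N : 0 < N
      0<N = <-≤-trans (≤-<-trans z≤n a<m) (m≤n+m m k)
      row₀ : Fin N
      row₀ = fromℕ< 0<N
      row₀≡0 : toℕ row₀ ≡ 0
      row₀≡0 = toℕ-fromℕ< 0<N

  meets-flag-only-at-pivot : ∀ {t} → m ≤ suc (a + t) → (i j : ℕ) → InB N m t i j →
    HasOne permutation i j → i ≡ 1 × j ≡ suc a
  meets-flag-only-at-pivot {t} m≤1+a+t _ _ b (r , refl , refl)
    with flag-entry-is-pivot m≤1+a+t (view r)
           (subst (λ v → InB N m t (suc (toℕ r)) (suc v)) (toℕ-value r) b)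
  ... | r≡0 , entry≡a = cong suc r≡0 , cong suc (trans (toℕ-value r) entry≡a)

lemma2p2 : (n m t : ℕ) → 1 ≤ n → 1 ≤ m → m ≤ n → t ≤ m ∸ 1 →
    (j : ℕ) → InB n m t 1 j →
    ∃[ P ] (Avoids123 {n} P × HasOne P 1 j ×
    ((i' j' : ℕ) → InB n m t i' j' → HasOne P i' j' → (i' ≡ 1 × j' ≡ j)))
lemma2p2 n m t _ 1≤m m≤n t≤m-1 j b with first-row-column 1≤m t≤m-1 b
... | a , refl , a<m , m≤1+a+t =
  subst Witness (m∸n+n≡m m≤n)
    (permutation , avoids123 , has-pivot , meets-flag-only-at-pivot m≤1+a+t)
  where
    open InflatedPermutation (n ∸ m) m a a<m
    Witness : ℕ → Set
    Witness n′ = ∃[ P ] (Avoids123 {n′} P × HasOne P 1 (suc a) ×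
      ((i' j' : ℕ) → InB n′ m t i' j' → HasOne P i' j' → (i' ≡ 1 × j' ≡ suc a)))
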